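{- Let $G$ and $H$ be finite groups with $|G|=|H|$ having the same number of elements of order $2$, and let $m>1$. Then for any $\mathbf{g}\in G^m$ and $\mathbf{h}\in H^m$ the graphs $\mathscr{V}_m(\mathbf{g},G)$ and $\mathscr{V}_m(\mathbf{h},H)$ are isomorphic.
   Context: For a finite group $G$ with identity $e$, $G^\times=G\setminus\{e\}$. For $x\in G^\times$ and $1\leqslant k<l\leqslant m+1$, $\mathbf{x}_{[k,l)}\in G^m$ has $j$-th coordinate $x$ for $k\leqslant j<l$ and $e$ otherwise; $\mathcal{S}$ is the set of all such $\mathbf{x}_{[k,l)}$, and $\mathscr{G}_m(G)=Cay(G^m,\mathcal{S})$ is the graph on $G^m$ with $\mathbf{g}\sim\mathbf{h}$ iff $\mathbf{h}\mathbf{g}^{ -1}\in\mathcal{S}$. For $\mathbf{g}\in G^m$, $V(\mathbf{g})$ is the set of neighbours of $\mathbf{g}$ in $\mathscr{G}_m(G)$, and $\mathscr{V}_m(\mathbf{g},G)$ is the subgraph of $\mathscr{G}_m(G)$ induced on $V(\mathbf{g})$. -}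

module Defs where

open import Level using (0ℓ)
open import Data.Nat using (ℕ; suc; _≤_; _<_; _≤?_; _<?_)
open import Data.Fin using (Fin; toℕ)
import Data.Fin.Properties as FinP
open import Data.Vec using (Vec; tabulate; zipWith; map)
open import Data.List using (List; length; filter; allFin)
open import Data.Product using (Σ; ∃; ∃-syntax; _×_; _,_)
open import Data.Bool using (if_then_else_)
open import Function using (_∘_)
open import Function.Bundles using (_↔_; Inverse; _⇔_)
open import Relation.Nullary using (¬_; Dec; yes; no; _×-dec_; ¬?)
open import Relation.Nullary.Decidable using (_because_)
open import Relation.Binary.PropositionalEquality using (_≡_; _≢_; refl; cong; sym; trans)
open import Algebra.Structures using (IsGroup)

record FiniteGroup : Set₁ where
  infixl 7 _∙_
  field
    Carrier : Set
    _∙_     : Carrier → Carrier → Carrier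
    e       : Carrier
    _⁻¹     : Carrier → Carrier
    isGroup : IsGroup _≡_ _∙_ e _⁻¹
    size    : ℕ
    enum    : Fin size ↔ Carrier

  _≟_ : (x y : Carrier) → Dec (x ≡ y)
  x ≟ y with FinP._≟_ (Inverse.from enum x) (Inverse.from enum y)
  ... | yes p = yes (trans (sym (Inverse.strictlyInverseˡ enum x))
                      (trans (cong (Inverse.to enum) p) (Inverse.strictlyInverseˡ enum y)))
  ... | no ¬p = no (λ q → ¬p (cong (Inverse.from enum) q))

  HasOrder2 : Carrier → Set
  HasOrder2 x = x ≢ e × x ∙ x ≡ e

  hasOrder2? : (x : Carrier) → Dec (HasOrder2 x)
  hasOrder2? x = ¬? (x ≟ e) ×-dec ((x ∙ x) ≟ e)

  numOrder2 : ℕ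
  numOrder2 = length (filter (hasOrder2? ∘ Inverse.to enum) (allFin size))

module _ (G : FiniteGroup) (m : ℕ) where
  open FiniteGroup G

  _·ᵥ_ : Vec Carrier m → Vec Carrier m → Vec Carrier m
  _·ᵥ_ = zipWith _∙_

  _⁻¹ᵥ : Vec Carrier m → Vec Carrier m
  _⁻¹ᵥ = map _⁻¹

  -- x_[k,l) : j-th coordinate (j = 1..m) is x if k ≤ j < l, e otherwise
  block : Carrier → ℕ → ℕ → Vec Carrier m
  block x k l = tabulate λ i →
    let j = suc (toℕ i) in
    if Relation.Nullary.Dec.does (k ≤? j ×-dec j <? l) then x else e

  InS : Vec Carrier m → Set
  InS v = ∃[ x ] ∃[ k ] ∃[ l ]
    (x ≢ e × 1 ≤ k × k < l × l ≤ suc m × v ≡ block x k l)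

  -- adjacency in the Cayley graph 𝒢_m(G) = Cay(G^m, 𝒮): g ∼ h iff h g⁻¹ ∈ 𝒮
  Adj : Vec Carrier m → Vec Carrier m → Set
  Adj g h = InS (h ·ᵥ (g ⁻¹ᵥ))

-- 𝒱_m(g,G) ≅ 𝒱_m(h,H): isomorphism of the induced subgraphs on the
-- neighbourhoods V(g) = {u | Adj g u} and V(h) = {u | Adj h u}:
-- maps φ, ψ restricting to mutually inverse bijections V(g) ⇄ V(h) and
-- preserving and reflecting adjacency on V(g).
record NbhdIso (G H : FiniteGroup) (m : ℕ)
       (g : Vec (FiniteGroup.Carrier G) m) (h : Vec (FiniteGroup.Carrier H) m) : Set where
  field
    φ : Vec (FiniteGroup.Carrier G) m → Vec (FiniteGroup.Carrier H) m
    ψ : Vec (FiniteGroup.Carrier H) m → Vec (FiniteGroup.Carrier G) m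
    φ-into : ∀ u → Adj G m g u → Adj H m h (φ u)
    ψ-into : ∀ v → Adj H m h v → Adj G m g (ψ v)
    ψφ : ∀ u → Adj G m g u → ψ (φ u) ≡ u
    φψ : ∀ v → Adj H m h v → φ (ψ v) ≡ v
    adj-pres : ∀ u u' → Adj G m g u → Adj G m g u' →
               Adj G m u u' ⇔ Adj H m (φ u) (φ u')

-- Right translation u ↦ u g⁻¹ is an automorphism of the Cayley graph sending g to the identity
-- vector ε, so it suffices to compare the neighbourhoods of ε, that is, the connection sets S of
-- G^m and H^m.  Whether a vector lies in S, and whether the quotient s′ s⁻¹ of two elements of S
-- does, depends only on which coordinates agree and which are trivial.  Hence a bijection
-- F : G → H with F e = e and F (a⁻¹) = (F a)⁻¹, applied coordinatewise, is an isomorphism of the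
-- neighbourhoods: the coordinates of s and s′ lie in sets {e, x} and {e, x′}, and on such a set
-- F (a′⁻¹ a) = (F a′)⁻¹ (F a), which is enough for F to preserve the equality pattern of s′ s⁻¹.
-- Such an F exists because inversion is an involution whose fixed points are e and the elements
-- of order 2, and two involutions of finite sets of equal size with equally many fixed points are
-- conjugate: pair off fixed points with fixed points and 2-cycles with 2-cycles, greedily.

module Submission where

open import Defs
open import Level using (0ℓ)
open import Data.Nat using (ℕ; suc; _+_; _<_; _≤?_; _<?_)
open import Data.Nat.Properties
  using (suc-injective; +-suc; +-cancelˡ-≡; ≤-<-trans; ≤-pred; ≤-trans; ≤-reflexive)
open import Data.Nat.Induction using (<-wellFounded)
open import Data.Fin using (Fin; toℕ; fromℕ<)
open import Data.Fin.Properties using (toℕ-fromℕ<)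
open import Data.Bool using (Bool; true; false; if_then_else_)
open import Data.Empty using (⊥-elim)
open import Data.Sum using (_⊎_; inj₁; inj₂)
open import Data.Product using (∃-syntax; _×_; _,_; proj₁; proj₂)
open import Data.List using (List; []; _∷_; length; filter; allFin)
import Data.List as List
open import Data.List.Properties
  using (filter-accept; filter-reject; filter-all; filter-some; filter-notAll;
         length-filter; length-map; length-tabulate)
open import Data.List.Membership.Propositional using (_∈_; _∉_; lose)
open import Data.List.Membership.Propositional.Properties using (∈-filter⁺; ∈-filter⁻; ∈-map⁺; ∈-allFin)
open import Data.List.Relation.Unary.Any using (here; there)
import Data.List.Relation.Unary.All as All
open import Data.List.Relation.Unary.AllPairs using (_∷_)
open import Data.List.Relation.Unary.Unique.Propositional using (Unique)
import Data.List.Relation.Unary.Unique.Propositional.Properties as Unique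
open import Data.List.Relation.Binary.Permutation.Propositional
  using (_↭_; ↭-refl; ↭-prep; ↭-swap; ↭-reflexive; module PermutationReasoning)
open import Data.List.Relation.Binary.Permutation.Propositional.Properties using (↭-length; filter-↭)
open import Data.Vec using (Vec; lookup; replicate; map)
open import Data.Vec.Properties
  using (zipWith-assoc; zipWith-identityˡ; zipWith-identityʳ; zipWith-inverseˡ; zipWith-inverseʳ;
         lookup∘tabulate; tabulate∘lookup; tabulate-cong; lookup-map; lookup-zipWith; map-∘; map-cong; map-id)
open import Function using (_∘_; const; _⇔_; mk⇔; Equivalence; Injection; Inverse)
open import Function.Properties.Equivalence using () renaming (sym to ⇔-sym; trans to ⇔-trans)
open import Function.Properties.Inverse using (↔⇒↣)
open import Induction.WellFounded using (Acc; acc)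
open import Relation.Nullary using (¬_; yes; no; ¬?; does; _×-dec_)
open import Relation.Nullary.Decidable using (dec-true)
open import Relation.Unary using (Pred; Decidable)
open import Relation.Binary using (DecidableEquality)
open import Relation.Binary.PropositionalEquality
  using (_≡_; _≢_; refl; sym; trans; cong; cong₂; subst; subst₂; isEquivalence; module ≡-Reasoning)
open import Algebra.Bundles using (Group)
import Algebra.Properties.Group as GroupProperties
import Algebra.Properties.Loop as LoopProperties
import Relation.Binary.Reasoning.Setoid as SetoidReasoning

-- Counting in lists

module _ {A : Set} {p} {P : Pred A p} (P? : Decidable P) where

  count : List A → ℕ
  count = length ∘ filter P?

  count-↭ : ∀ {xs ys} → xs ↭ ys → count xs ≡ count ys
  count-↭ = ↭-length ∘ filter-↭ P?

  count-accept : ∀ {x} xs → P x → count (x ∷ xs) ≡ suc (count xs)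
  count-accept xs px = cong length (filter-accept P? px)

  count-reject : ∀ {x} xs → ¬ P x → count (x ∷ xs) ≡ count xs
  count-reject xs ¬px = cong length (filter-reject P? ¬px)

  count-complement : ∀ xs → count xs + length (filter (¬? ∘ P?) xs) ≡ length xs
  count-complement []       = refl
  count-complement (x ∷ xs) with P? x
  ... | yes _ = cong suc (count-complement xs)
  ... | no  _ = trans (+-suc (count xs) _) (cong suc (count-complement xs))

  ∈⇒count-pos : ∀ {x xs} → x ∈ xs → P x → 0 < count xs
  ∈⇒count-pos x∈ px = filter-some P? (lose x∈ px)

  count-pos⇒∈ : ∀ xs → 0 < count xs → ∃[ y ] y ∈ xs × P y
  count-pos⇒∈ xs pos with filter P? xs in eq
  ... | y ∷ _ = y , ∈-filter⁻ P? (subst (y ∈_) (sym eq) (here refl))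

module _ {A B : Set} {p} {P : Pred B p} (P? : Decidable P) (f : A → B) where

  count-map : ∀ xs → count P? (List.map f xs) ≡ count (P? ∘ f) xs
  count-map []       = refl
  count-map (x ∷ xs) with P? (f x)
  ... | yes _ = cong suc (count-map xs)
  ... | no  _ = count-map xs

module _ {A : Set} {p q} {P : Pred A p} {Q : Pred A q} (P? : Decidable P) (Q? : Decidable Q) where

  count-cong : ∀ {xs} → (∀ {a} → a ∈ xs → P a ⇔ Q a) → count P? xs ≡ count Q? xs
  count-cong {[]}     _   = refl
  count-cong {x ∷ xs} P⇔Q with P? x | Q? x
  ... | yes _  | yes _  = cong suc (count-cong (P⇔Q ∘ there))
  ... | no  _  | no  _  = count-cong (P⇔Q ∘ there)
  ... | yes px | no ¬qx = ⊥-elim (¬qx (Equivalence.to (P⇔Q (here refl)) px))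
  ... | no ¬px | yes qx = ⊥-elim (¬px (Equivalence.from (P⇔Q (here refl)) qx))

module _ {A : Set} (_≟_ : DecidableEquality A) where

  remove : A → List A → List A
  remove x = filter (λ a → ¬? (a ≟ x))

  ∈-remove⁻ : ∀ {a x xs} → a ∈ remove x xs → a ∈ xs × a ≢ x
  ∈-remove⁻ = ∈-filter⁻ (λ a → ¬? (a ≟ _))

  ∈-remove⁺ : ∀ {a x xs} → a ∈ xs → a ≢ x → a ∈ remove x xs
  ∈-remove⁺ = ∈-filter⁺ (λ a → ¬? (a ≟ _))

  remove-unique : ∀ {x xs} → Unique xs → Unique (remove x xs)
  remove-unique = Unique.filter⁺ (λ a → ¬? (a ≟ _))

  remove-∉ : ∀ {x xs} → x ∉ xs → remove x xs ≡ xs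
  remove-∉ x∉ = filter-all (λ a → ¬? (a ≟ _)) (All.tabulate λ a∈ a≡x → x∉ (subst (_∈ _) a≡x a∈))

  remove-↭ : ∀ {x xs} → Unique xs → x ∈ xs → xs ↭ x ∷ remove x xs
  remove-↭ {x} {.x ∷ ys} (x≢ ∷ _) (here refl) = ↭-prep x (↭-reflexive (sym (begin
    remove x (x ∷ ys) ≡⟨ filter-reject (λ a → ¬? (a ≟ x)) (λ x≢x → x≢x refl) ⟩
    remove x ys       ≡⟨ remove-∉ (λ x∈ → All.lookup x≢ x∈ refl) ⟩
    ys                ∎)))
    where open ≡-Reasoning
  remove-↭ {x} {y ∷ ys} (y≢ ∷ u) (there x∈) = begin
    y ∷ ys                ↭⟨ ↭-prep y (remove-↭ u x∈) ⟩
    y ∷ x ∷ remove x ys   ↭⟨ ↭-swap y x ↭-refl ⟩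
    x ∷ y ∷ remove x ys   ≡⟨ cong (x ∷_) (filter-accept (λ a → ¬? (a ≟ x)) (All.lookup y≢ x∈)) ⟨
    x ∷ remove x (y ∷ ys) ∎
    where open PermutationReasoning

-- Equivariant bijections between involutive finite sets

Closed : {A : Set} → (A → A) → List A → Set
Closed σ xs = ∀ {a} → a ∈ xs → σ a ∈ xs

module Orbits {A : Set} (_≟_ : DecidableEquality A) (σ : A → A) (σ-involutive : ∀ a → σ (σ a) ≡ a) where

  Fixed : A → Set
  Fixed a = σ a ≡ a

  fixed? : Decidable Fixed
  fixed? a = σ a ≟ a

  σ-injective : ∀ {a b} → σ a ≡ σ b → a ≡ b
  σ-injective {a} {b} σa≡σb = trans (sym (σ-involutive a)) (trans (cong σ σa≡σb) (σ-involutive b))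

  removeOrbit : A → List A → List A
  removeOrbit x = remove _≟_ (σ x) ∘ remove _≟_ x

  ∈-removeOrbit⁻ : ∀ {a x} xs → a ∈ removeOrbit x xs → a ∈ xs × a ≢ x × a ≢ σ x
  ∈-removeOrbit⁻ xs a∈ with ∈-remove⁻ _≟_ {xs = remove _≟_ _ xs} a∈
  ... | a∈′ , a≢σx with ∈-remove⁻ _≟_ {xs = xs} a∈′
  ... | a∈xs , a≢x = a∈xs , a≢x , a≢σx

  ∈-removeOrbit⁺ : ∀ {a x xs} → a ∈ xs → a ≢ x → a ≢ σ x → a ∈ removeOrbit x xs
  ∈-removeOrbit⁺ a∈ a≢x a≢σx = ∈-remove⁺ _≟_ (∈-remove⁺ _≟_ a∈ a≢x) a≢σx

  removeOrbit-unique : ∀ {x xs} → Unique xs → Unique (removeOrbit x xs)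
  removeOrbit-unique = remove-unique _≟_ ∘ remove-unique _≟_

  removeOrbit-closed : ∀ {x xs} → Closed σ xs → Closed σ (removeOrbit x xs)
  removeOrbit-closed {x} {xs} closed a∈ with ∈-removeOrbit⁻ xs a∈
  ... | a∈xs , a≢x , a≢σx = ∈-removeOrbit⁺ (closed a∈xs)
    (λ σa≡x → a≢σx (trans (sym (σ-involutive _)) (cong σ σa≡x)))
    (λ σa≡σx → a≢x (σ-injective σa≡σx))

  ∈-orbit⊎removeOrbit : ∀ {a x xs} → a ∈ xs → a ≡ x ⊎ a ≡ σ x ⊎ a ∈ removeOrbit x xs
  ∈-orbit⊎removeOrbit {a} {x} a∈ with a ≟ x | a ≟ σ x
  ... | yes a≡x | _         = inj₁ a≡x
  ... | no _    | yes a≡σx  = inj₂ (inj₁ a≡σx)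
  ... | no a≢x  | no a≢σx   = inj₂ (inj₂ (∈-removeOrbit⁺ a∈ a≢x a≢σx))

  removeOrbit-↭-fixed : ∀ {x xs} → Unique xs → x ∈ xs → Fixed x → xs ↭ x ∷ removeOrbit x xs
  removeOrbit-↭-fixed {x} {xs} u x∈ σx≡x = begin
    xs                                ↭⟨ remove-↭ _≟_ u x∈ ⟩
    x ∷ remove _≟_ x xs               ≡⟨ cong (x ∷_) (remove-∉ _≟_ σx∉) ⟨
    x ∷ removeOrbit x xs              ∎
    where
    open PermutationReasoning
    σx∉ : σ x ∉ remove _≟_ x xs
    σx∉ σx∈ = proj₂ (∈-remove⁻ _≟_ {xs = xs} σx∈) σx≡x

  removeOrbit-↭-moved : ∀ {x xs} → Unique xs → x ∈ xs → σ x ∈ xs → ¬ Fixed x →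
                        xs ↭ x ∷ σ x ∷ removeOrbit x xs
  removeOrbit-↭-moved {x} {xs} u x∈ σx∈ σx≢x = begin
    xs                       ↭⟨ remove-↭ _≟_ u x∈ ⟩
    x ∷ remove _≟_ x xs      ↭⟨ ↭-prep x (remove-↭ _≟_ (remove-unique _≟_ u) (∈-remove⁺ _≟_ σx∈ σx≢x)) ⟩
    x ∷ σ x ∷ removeOrbit x xs ∎
    where open PermutationReasoning

  removeOrbit-shorter : ∀ {x xs} → x ∈ xs → length (removeOrbit x xs) < length xs
  removeOrbit-shorter {x} {xs} x∈ = ≤-<-trans (length-filter (λ a → ¬? (a ≟ σ x)) (remove _≟_ x xs))
    (filter-notAll (λ a → ¬? (a ≟ x)) xs (lose x∈ (λ x≢x → x≢x refl)))

  counts-removeOrbit-fixed : ∀ {x xs} → Unique xs → x ∈ xs → Fixed x →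
    length xs ≡ suc (length (removeOrbit x xs)) × count fixed? xs ≡ suc (count fixed? (removeOrbit x xs))
  counts-removeOrbit-fixed {x} {xs} u x∈ σx≡x =
    ↭-length split , trans (count-↭ fixed? split) (count-accept fixed? _ σx≡x)
    where
    split : xs ↭ x ∷ removeOrbit x xs
    split = removeOrbit-↭-fixed u x∈ σx≡x

  counts-removeOrbit-moved : ∀ {x xs} → Unique xs → Closed σ xs → x ∈ xs → ¬ Fixed x →
    length xs ≡ suc (suc (length (removeOrbit x xs))) × count fixed? xs ≡ count fixed? (removeOrbit x xs)
  counts-removeOrbit-moved {x} {xs} u closed x∈ σx≢x = ↭-length split , (begin
    count fixed? xs                             ≡⟨ count-↭ fixed? split ⟩
    count fixed? (x ∷ σ x ∷ removeOrbit x xs)   ≡⟨ count-reject fixed? _ σx≢x ⟩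
    count fixed? (σ x ∷ removeOrbit x xs)       ≡⟨ count-reject fixed? _ σσx≢σx ⟩
    count fixed? (removeOrbit x xs)             ∎)
    where
    open ≡-Reasoning
    split : xs ↭ x ∷ σ x ∷ removeOrbit x xs
    split = removeOrbit-↭-moved u x∈ (closed x∈) σx≢x
    σσx≢σx : ¬ Fixed (σ x)
    σσx≢σx σσx≡σx = σx≢x (sym (trans (sym (σ-involutive x)) σσx≡σx))

record EquivariantBijection {A B : Set} (σ : A → A) (τ : B → B) (xs : List A) (ys : List B) : Set where
  field
    to      : A → B
    from    : B → A
    to-∈    : ∀ {a} → a ∈ xs → to a ∈ ys
    from-∈  : ∀ {b} → b ∈ ys → from b ∈ xs
    from-to : ∀ {a} → a ∈ xs → from (to a) ≡ a
    to-from : ∀ {b} → b ∈ ys → to (from b) ≡ b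
    to-σ    : ∀ {a} → a ∈ xs → to (σ a) ≡ τ (to a)
    from-τ  : ∀ {b} → b ∈ ys → from (τ b) ≡ σ (from b)

module _ {A B : Set} {σ : A → A} {τ : B → B} where

  EquivariantBijection-sym : ∀ {xs ys} → EquivariantBijection σ τ xs ys → EquivariantBijection τ σ ys xs
  EquivariantBijection-sym M = record
    { to = from ; from = to ; to-∈ = from-∈ ; from-∈ = to-∈
    ; from-to = to-from ; to-from = from-to ; to-σ = from-τ ; from-τ = to-σ }
    where open EquivariantBijection M

  EquivariantBijection-[] : A → B → EquivariantBijection σ τ [] []
  EquivariantBijection-[] a₀ b₀ = record
    { to = λ _ → b₀ ; from = λ _ → a₀ ; to-∈ = λ () ; from-∈ = λ ()
    ; from-to = λ () ; to-from = λ () ; to-σ = λ () ; from-τ = λ () }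

module Patch {X Y : Set} (_≟_ : DecidableEquality X) (σ : X → X) (τ : Y → Y) where

  patch : X → Y → (X → Y) → X → Y
  patch x y f a with a ≟ x | a ≟ σ x
  ... | yes _ | _     = y
  ... | no _  | yes _ = τ y
  ... | no _  | no _  = f a

  patch-here : ∀ {x y f} → patch x y f x ≡ y
  patch-here {x} with x ≟ x
  ... | yes _   = refl
  ... | no x≢x = ⊥-elim (x≢x refl)

  patch-σ : ∀ {x y f} → (σ x ≡ x → τ y ≡ y) → patch x y f (σ x) ≡ τ y
  patch-σ {x} fixed⇒fixed with σ x ≟ x | σ x ≟ σ x
  ... | yes σx≡x | _       = sym (fixed⇒fixed σx≡x)
  ... | no _     | yes _   = refl
  ... | no _     | no σx≢σx = ⊥-elim (σx≢σx refl)

  patch-elsewhere : ∀ {x y f a} → a ≢ x → a ≢ σ x → patch x y f a ≡ f a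
  patch-elsewhere {x} {a = a} a≢x a≢σx with a ≟ x | a ≟ σ x
  ... | yes a≡x | _         = ⊥-elim (a≢x a≡x)
  ... | no _    | yes a≡σx  = ⊥-elim (a≢σx a≡σx)
  ... | no _    | no _      = refl

module ExtendHalf {X Y : Set} (_≟X_ : DecidableEquality X) (_≟Y_ : DecidableEquality Y)
  {σ : X → X} {τ : Y → Y} (σ-involutive : ∀ a → σ (σ a) ≡ a) (τ-involutive : ∀ b → τ (τ b) ≡ b)
  {x y xs ys} (x∈ : x ∈ xs) (y∈ : y ∈ ys) (xs-closed : Closed σ xs) (ys-closed : Closed τ ys)
  (fixed⇔fixed : σ x ≡ x ⇔ τ y ≡ y)
  (M : EquivariantBijection σ τ (Orbits.removeOrbit _≟X_ σ σ-involutive x xs)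
                                (Orbits.removeOrbit _≟Y_ τ τ-involutive y ys)) where

  open EquivariantBijection M
  module OX = Orbits _≟X_ σ σ-involutive
  module OY = Orbits _≟Y_ τ τ-involutive
  module PX = Patch _≟X_ σ τ
  module PY = Patch _≟Y_ τ σ

  to′ : X → Y
  to′ = PX.patch x y to

  from′ : Y → X
  from′ = PY.patch y x from

  to′-elsewhere : ∀ {a} → a ∈ OX.removeOrbit x xs → to′ a ≡ to a
  to′-elsewhere a∈ with OX.∈-removeOrbit⁻ xs a∈
  ... | _ , a≢x , a≢σx = PX.patch-elsewhere a≢x a≢σx

  from′-elsewhere : ∀ {b} → b ∈ OY.removeOrbit y ys → from′ b ≡ from b
  from′-elsewhere b∈ with OY.∈-removeOrbit⁻ ys b∈
  ... | _ , b≢y , b≢τy = PY.patch-elsewhere b≢y b≢τy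

  to′-∈ : ∀ {a} → a ∈ xs → to′ a ∈ ys
  to′-∈ a∈ with OX.∈-orbit⊎removeOrbit {x = x} a∈
  ... | inj₁ refl         = subst (_∈ ys) (sym PX.patch-here) y∈
  ... | inj₂ (inj₁ refl)  = subst (_∈ ys) (sym (PX.patch-σ (Equivalence.to fixed⇔fixed))) (ys-closed y∈)
  ... | inj₂ (inj₂ a∈′)   =
    subst (_∈ ys) (sym (to′-elsewhere a∈′)) (proj₁ (OY.∈-removeOrbit⁻ ys (to-∈ a∈′)))

  from′-to′ : ∀ {a} → a ∈ xs → from′ (to′ a) ≡ a
  from′-to′ {a} a∈ with OX.∈-orbit⊎removeOrbit {x = x} a∈
  ... | inj₁ refl         = trans (cong from′ PX.patch-here) PY.patch-here
  ... | inj₂ (inj₁ refl)  = trans (cong from′ (PX.patch-σ (Equivalence.to fixed⇔fixed)))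
                                  (PY.patch-σ (Equivalence.from fixed⇔fixed))
  ... | inj₂ (inj₂ a∈′)   = begin
    from′ (to′ a) ≡⟨ cong from′ (to′-elsewhere a∈′) ⟩
    from′ (to a)  ≡⟨ from′-elsewhere (to-∈ a∈′) ⟩
    from (to a)   ≡⟨ from-to a∈′ ⟩
    a             ∎
    where open ≡-Reasoning

  to′-σ : ∀ {a} → a ∈ xs → to′ (σ a) ≡ τ (to′ a)
  to′-σ {a} a∈ with OX.∈-orbit⊎removeOrbit {x = x} a∈
  ... | inj₁ refl         = trans (PX.patch-σ (Equivalence.to fixed⇔fixed)) (cong τ (sym PX.patch-here))
  ... | inj₂ (inj₁ refl)  = begin
    to′ (σ (σ x)) ≡⟨ cong to′ (σ-involutive x) ⟩
    to′ x         ≡⟨ PX.patch-here ⟩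
    y             ≡⟨ τ-involutive y ⟨
    τ (τ y)       ≡⟨ cong τ (PX.patch-σ (Equivalence.to fixed⇔fixed)) ⟨
    τ (to′ (σ x)) ∎
    where open ≡-Reasoning
  ... | inj₂ (inj₂ a∈′)   = begin
    to′ (σ a) ≡⟨ to′-elsewhere (OX.removeOrbit-closed xs-closed a∈′) ⟩
    to (σ a)  ≡⟨ to-σ a∈′ ⟩
    τ (to a)  ≡⟨ cong τ (to′-elsewhere a∈′) ⟨
    τ (to′ a) ∎
    where open ≡-Reasoning

module _ {A B : Set} (_≟A_ : DecidableEquality A) (_≟B_ : DecidableEquality B)
  {σ : A → A} {τ : B → B} (σ-involutive : ∀ a → σ (σ a) ≡ a) (τ-involutive : ∀ b → τ (τ b) ≡ b) where

  module OA = Orbits _≟A_ σ σ-involutive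
  module OB = Orbits _≟B_ τ τ-involutive

  extend : ∀ {x y xs ys} → x ∈ xs → y ∈ ys → Closed σ xs → Closed τ ys → (σ x ≡ x ⇔ τ y ≡ y) →
           EquivariantBijection σ τ (OA.removeOrbit x xs) (OB.removeOrbit y ys) →
           EquivariantBijection σ τ xs ys
  extend x∈ y∈ xs-closed ys-closed fixed⇔fixed M = record
    { to = A.to′ ; from = A.from′ ; to-∈ = A.to′-∈ ; from-∈ = B.to′-∈
    ; from-to = A.from′-to′ ; to-from = B.from′-to′ ; to-σ = A.to′-σ ; from-τ = B.to′-σ }
    where
    module A = ExtendHalf _≟A_ _≟B_ σ-involutive τ-involutive x∈ y∈ xs-closed ys-closed fixed⇔fixed M
    module B = ExtendHalf _≟B_ _≟A_ τ-involutive σ-involutive y∈ x∈ ys-closed xs-closed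
                 (⇔-sym fixed⇔fixed) (EquivariantBijection-sym M)

  record SameShape (xs : List A) (ys : List B) : Set where
    field
      unique-xs : Unique xs
      unique-ys : Unique ys
      closed-xs : Closed σ xs
      closed-ys : Closed τ ys
      length-≡  : length xs ≡ length ys
      fixed-≡   : count OA.fixed? xs ≡ count OB.fixed? ys

    moved-≡ : count (¬? ∘ OA.fixed?) xs ≡ count (¬? ∘ OB.fixed?) ys
    moved-≡ = +-cancelˡ-≡ (count OA.fixed? xs) _ _ (begin
      count OA.fixed? xs + count (¬? ∘ OA.fixed?) xs ≡⟨ count-complement OA.fixed? xs ⟩
      length xs                                      ≡⟨ length-≡ ⟩
      length ys                                      ≡⟨ count-complement OB.fixed? ys ⟨
      count OB.fixed? ys + count (¬? ∘ OB.fixed?) ys ≡⟨ cong (_+ _) fixed-≡ ⟨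
      count OA.fixed? xs + count (¬? ∘ OB.fixed?) ys ∎)
      where open ≡-Reasoning

  partner : ∀ {x xs ys} → SameShape xs ys → x ∈ xs → ∃[ y ] y ∈ ys × (σ x ≡ x ⇔ τ y ≡ y)
  partner {x} {ys = ys} s x∈ with OA.fixed? x
  ... | yes σx≡x =
    let y , y∈ , τy≡y = count-pos⇒∈ OB.fixed? ys
                          (subst (0 <_) (SameShape.fixed-≡ s) (∈⇒count-pos OA.fixed? x∈ σx≡x))
    in y , y∈ , mk⇔ (const τy≡y) (const σx≡x)
  ... | no σx≢x =
    let y , y∈ , τy≢y = count-pos⇒∈ (¬? ∘ OB.fixed?) ys
                          (subst (0 <_) (SameShape.moved-≡ s) (∈⇒count-pos (¬? ∘ OA.fixed?) x∈ σx≢x))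
    in y , y∈ , mk⇔ (⊥-elim ∘ σx≢x) (⊥-elim ∘ τy≢y)

  SameShape-removeOrbit : ∀ {x y xs ys} → SameShape xs ys → x ∈ xs → y ∈ ys → (σ x ≡ x ⇔ τ y ≡ y) →
                        SameShape (OA.removeOrbit x xs) (OB.removeOrbit y ys)
  SameShape-removeOrbit {x} {y} {xs} {ys} s x∈ y∈ fixed⇔fixed = record
    { unique-xs = OA.removeOrbit-unique unique-xs
    ; unique-ys = OB.removeOrbit-unique unique-ys
    ; closed-xs = OA.removeOrbit-closed closed-xs
    ; closed-ys = OB.removeOrbit-closed closed-ys
    ; length-≡  = proj₁ counts-≡
    ; fixed-≡   = proj₂ counts-≡
    }
    where
    open SameShape s
    counts-≡ : length (OA.removeOrbit x xs) ≡ length (OB.removeOrbit y ys)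
             × count OA.fixed? (OA.removeOrbit x xs) ≡ count OB.fixed? (OB.removeOrbit y ys)
    counts-≡ with OA.fixed? x
    ... | yes σx≡x =
      let |xs| , #xs = OA.counts-removeOrbit-fixed unique-xs x∈ σx≡x
          |ys| , #ys = OB.counts-removeOrbit-fixed unique-ys y∈ (Equivalence.to fixed⇔fixed σx≡x)
      in suc-injective (trans (sym |xs|) (trans length-≡ |ys|))
       , suc-injective (trans (sym #xs) (trans fixed-≡ #ys))
    ... | no σx≢x =
      let |xs| , #xs = OA.counts-removeOrbit-moved unique-xs closed-xs x∈ σx≢x
          |ys| , #ys = OB.counts-removeOrbit-moved unique-ys closed-ys y∈ (σx≢x ∘ Equivalence.from fixed⇔fixed)
      in suc-injective (suc-injective (trans (sym |xs|) (trans length-≡ |ys|)))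
       , trans (sym #xs) (trans fixed-≡ #ys)

  -- The maps are only constrained on the lists; a₀ and b₀ are arbitrary values for the empty case.
  equivariantBijection : A → B → ∀ {xs ys} → SameShape xs ys → EquivariantBijection σ τ xs ys
  equivariantBijection a₀ b₀ = go (<-wellFounded _)
    where
    go : ∀ {xs ys} → Acc _<_ (length xs) → SameShape xs ys → EquivariantBijection σ τ xs ys
    go {[]}    {[]}    _         _ = EquivariantBijection-[] a₀ b₀
    go {[]}    {_ ∷ _} _         s with () ← SameShape.length-≡ s
    go {x ∷ _} {_}     (acc rec) s with partner s (here refl)
    ... | y , y∈ , fixed⇔fixed =
      extend (here refl) y∈ (SameShape.closed-xs s) (SameShape.closed-ys s) fixed⇔fixed
        (go (rec (OA.removeOrbit-shorter (here refl))) (SameShape-removeOrbit s (here refl) y∈ fixed⇔fixed))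

-- Groups

module _ {c ℓ} (𝔾 : Group c ℓ) where

  open Group 𝔾
  open GroupProperties 𝔾
  open SetoidReasoning setoid

  //-≈⇒\\-≈ : ∀ {a b a′ b′} → a // b ≈ a′ // b′ → a′ \\ a ≈ b′ \\ b
  //-≈⇒\\-≈ {a} {b} {a′} {b′} eq = begin
    a′ \\ a                ≈⟨ ∙-congˡ (//-rightDividesˡ b a) ⟨
    a′ \\ ((a // b) ∙ b)   ≈⟨ ∙-congˡ (∙-congʳ eq) ⟩
    a′ \\ ((a′ // b′) ∙ b) ≈⟨ ∙-congˡ (assoc a′ (b′ ⁻¹) b) ⟩
    a′ \\ (a′ ∙ (b′ \\ b)) ≈⟨ \\-leftDividesʳ a′ (b′ \\ b) ⟩
    b′ \\ b                ∎

  \\-≈⇒//-≈ : ∀ {a b a′ b′} → a′ \\ a ≈ b′ \\ b → a // b ≈ a′ // b′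
  \\-≈⇒//-≈ {a} {b} {a′} {b′} eq = begin
    a // b                 ≈⟨ ∙-congʳ (\\-leftDividesˡ a′ a) ⟨
    a′ ∙ (a′ \\ a) // b    ≈⟨ ∙-congʳ (∙-congˡ eq) ⟩
    a′ ∙ (b′ \\ b) // b    ≈⟨ ∙-congʳ (assoc a′ (b′ ⁻¹) b) ⟨
    (a′ // b′) ∙ b // b    ≈⟨ //-rightDividesʳ b (a′ // b′) ⟩
    a′ // b′               ∎

  ∙-//-cancelʳ : ∀ x y z → x ∙ z // y ∙ z ≈ x // y
  ∙-//-cancelʳ x y z = begin
    x ∙ z ∙ (y ∙ z) ⁻¹   ≈⟨ ∙-congˡ (⁻¹-anti-homo-∙ y z) ⟩
    x ∙ z ∙ (z ⁻¹ ∙ y ⁻¹) ≈⟨ assoc x z (z ⁻¹ ∙ y ⁻¹) ⟩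
    x ∙ (z ∙ (z \\ y ⁻¹)) ≈⟨ ∙-congˡ (\\-leftDividesˡ z (y ⁻¹)) ⟩
    x // y               ∎

module FiniteGroupProperties (G : FiniteGroup) where

  open FiniteGroup G public

  group : Group 0ℓ 0ℓ
  group = record { _≈_ = _≡_ ; _∙_ = _∙_ ; ε = e ; _⁻¹ = _⁻¹ ; isGroup = isGroup }

  open Group group public using (_//_; _\\_; assoc; identityˡ; identityʳ; inverseˡ; inverseʳ)
  open GroupProperties group public
  open LoopProperties loop public using (ε\\x≈x; x\\x≈ε)

  infix 4 _∈⟨e,_⟩
  _∈⟨e,_⟩ : Carrier → Carrier → Set
  a ∈⟨e, x ⟩ = a ≡ e ⊎ a ≡ x

  elements : List Carrier
  elements = List.map (Inverse.to enum) (allFin size)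

  elements-unique : Unique elements
  elements-unique = Unique.map⁺ (Injection.injective (↔⇒↣ enum)) (Unique.allFin⁺ size)

  ∈-elements : ∀ a → a ∈ elements
  ∈-elements a = subst (_∈ elements) (Inverse.strictlyInverseˡ enum a) (∈-map⁺ _ (∈-allFin _))

  length-elements : length elements ≡ size
  length-elements = trans (length-map _ (allFin size)) (length-tabulate _)

  open Orbits _≟_ _⁻¹ ⁻¹-involutive

  fixed⇔order2 : ∀ {a} → a ≢ e → Fixed a ⇔ HasOrder2 a
  fixed⇔order2 {a} a≢e = mk⇔
    (λ a⁻¹≡a → a≢e , trans (cong (a ∙_) (sym a⁻¹≡a)) (inverseʳ a))
    (λ (_ , a∙a≡e) → sym (inverseˡ-unique a a a∙a≡e))

  count-fixed-elements : count fixed? elements ≡ suc numOrder2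
  count-fixed-elements = trans (proj₂ (counts-removeOrbit-fixed elements-unique e∈ ε⁻¹≈ε)) (cong suc (begin
    count fixed? rest            ≡⟨ count-cong fixed? hasOrder2? (fixed⇔order2 ∘ rest-≢e) ⟩
    count hasOrder2? rest        ≡⟨ count-reject hasOrder2? rest (λ (e≢e , _) → e≢e refl) ⟨
    count hasOrder2? (e ∷ rest)  ≡⟨ count-↭ hasOrder2? (removeOrbit-↭-fixed elements-unique e∈ ε⁻¹≈ε) ⟨
    count hasOrder2? elements    ≡⟨ count-map hasOrder2? (Inverse.to enum) (allFin size) ⟩
    numOrder2                    ∎))
    where
    open ≡-Reasoning
    e∈ : e ∈ elements
    e∈ = ∈-elements e
    rest : List Carrier
    rest = removeOrbit e elements
    rest-≢e : ∀ {a} → a ∈ rest → a ≢ e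
    rest-≢e a∈ = proj₁ (proj₂ (∈-removeOrbit⁻ elements a∈))

record InverseCompatibleBijection (G H : FiniteGroup) : Set where
  open FiniteGroup G using () renaming (Carrier to A; e to eA; _⁻¹ to _⁻¹A)
  open FiniteGroup H using () renaming (Carrier to B; e to eB; _⁻¹ to _⁻¹B)
  field
    to      : A → B
    from    : B → A
    from-to : ∀ a → from (to a) ≡ a
    to-from : ∀ b → to (from b) ≡ b
    to-e    : to eA ≡ eB
    to-⁻¹   : ∀ a → to (a ⁻¹A) ≡ to a ⁻¹B

  to-injective : ∀ {a a′} → to a ≡ to a′ → a ≡ a′
  to-injective {a} {a′} p = trans (sym (from-to a)) (trans (cong from p) (from-to a′))

  from-injective : ∀ {b b′} → from b ≡ from b′ → b ≡ b′
  from-injective {b} {b′} p = trans (sym (to-from b)) (trans (cong to p) (to-from b′))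

  from-e : from eB ≡ eA
  from-e = trans (cong from (sym to-e)) (from-to eA)

inverseCompatibleBijection : (G H : FiniteGroup) →
  FiniteGroup.size G ≡ FiniteGroup.size H → FiniteGroup.numOrder2 G ≡ FiniteGroup.numOrder2 H →
  InverseCompatibleBijection G H
inverseCompatibleBijection G H |G|≡|H| #G≡#H = record
  { to = to ; from = from
  ; from-to = from-to ∘ G.∈-elements ; to-from = to-from ∘ H.∈-elements
  ; to-e = Patch.patch-here G._≟_ G._⁻¹ H._⁻¹
  ; to-⁻¹ = to-σ ∘ G.∈-elements
  }
  where
  module G = FiniteGroupProperties G
  module H = FiniteGroupProperties H
  e-fixed⇔e-fixed : G.e G.⁻¹ ≡ G.e ⇔ H.e H.⁻¹ ≡ H.e
  e-fixed⇔e-fixed = mk⇔ (λ _ → H.ε⁻¹≈ε) (λ _ → G.ε⁻¹≈ε)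
  sameShape : SameShape G._≟_ H._≟_ G.⁻¹-involutive H.⁻¹-involutive G.elements H.elements
  sameShape = record
    { unique-xs = G.elements-unique
    ; unique-ys = H.elements-unique
    ; closed-xs = λ _ → G.∈-elements _
    ; closed-ys = λ _ → H.∈-elements _
    ; length-≡  = trans G.length-elements (trans |G|≡|H| (sym H.length-elements))
    ; fixed-≡   = trans G.count-fixed-elements (trans (cong suc #G≡#H) (sym H.count-fixed-elements))
    }
  open EquivariantBijection (extend G._≟_ H._≟_ G.⁻¹-involutive H.⁻¹-involutive
    (G.∈-elements G.e) (H.∈-elements H.e) (λ _ → G.∈-elements _) (λ _ → H.∈-elements _) e-fixed⇔e-fixed
    (equivariantBijection G._≟_ H._≟_ G.⁻¹-involutive H.⁻¹-involutive G.e H.e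
      (SameShape-removeOrbit G._≟_ H._≟_ G.⁻¹-involutive H.⁻¹-involutive sameShape
        (G.∈-elements G.e) (H.∈-elements H.e) e-fixed⇔e-fixed)))

-- Neighbourhoods in the Cayley graph of G^m

≡-resp-⇔ : ∀ {A B : Set} {a a′ b b′ : A} {c c′ d d′ : B} → a′ ≡ a → b′ ≡ b → c′ ≡ c → d′ ≡ d →
           (a ≡ b ⇔ c ≡ d) → (a′ ≡ b′ ⇔ c′ ≡ d′)
≡-resp-⇔ refl refl refl refl a≡b⇔c≡d = a≡b⇔c≡d

vecGroup : FiniteGroup → ℕ → Group 0ℓ 0ℓ
vecGroup G m = record
  { _≈_ = _≡_ ; _∙_ = _·ᵥ_ G m ; ε = replicate m e ; _⁻¹ = _⁻¹ᵥ G m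
  ; isGroup = record
    { isMonoid = record
      { isSemigroup = record
        { isMagma = record { isEquivalence = isEquivalence ; ∙-cong = cong₂ _ }
        ; assoc   = zipWith-assoc assoc }
      ; identity = zipWith-identityˡ identityˡ , zipWith-identityʳ identityʳ }
    ; inverse = zipWith-inverseˡ inverseˡ , zipWith-inverseʳ inverseʳ
    ; ⁻¹-cong = cong _ } }
  where open FiniteGroupProperties G

NbhdIso-trans : ∀ {G H K m g h k} → NbhdIso G H m g h → NbhdIso H K m h k → NbhdIso G K m g k
NbhdIso-trans I J = record
  { φ        = J.φ ∘ I.φ
  ; ψ        = I.ψ ∘ J.ψ
  ; φ-into   = λ u u∼g → J.φ-into _ (I.φ-into u u∼g)
  ; ψ-into   = λ w w∼k → I.ψ-into _ (J.ψ-into w w∼k)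
  ; ψφ       = λ u u∼g → trans (cong I.ψ (J.ψφ _ (I.φ-into u u∼g))) (I.ψφ u u∼g)
  ; φψ       = λ w w∼k → trans (cong J.φ (I.φψ _ (J.ψ-into w w∼k))) (J.φψ w w∼k)
  ; adj-pres = λ u u′ u∼g u′∼g → ⇔-trans (I.adj-pres u u′ u∼g u′∼g)
                                         (J.adj-pres _ _ (I.φ-into u u∼g) (I.φ-into u′ u′∼g))
  }
  where
  module I = NbhdIso I
  module J = NbhdIso J

module _ {G : FiniteGroup} {m : ℕ} where

  open Group (vecGroup G m) using (_∙_; _⁻¹; _//_; _\\_)
  open GroupProperties (vecGroup G m) using (\\-leftDividesˡ; //-rightDividesˡ; //-rightDividesʳ)

  Adj-translate : ∀ k {u u′} → Adj G m u u′ → Adj G m (u ∙ k) (u′ ∙ k)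
  Adj-translate k {u} {u′} = subst (InS G m) (sym (∙-//-cancelʳ (vecGroup G m) u′ u k))

  translationIso : (g g′ : Vec (FiniteGroup.Carrier G) m) → NbhdIso G G m g g′
  translationIso g g′ = record
    { φ        = _∙ k
    ; ψ        = _// k
    ; φ-into   = λ u u∼g → subst (λ x → Adj G m x (u ∙ k)) (\\-leftDividesˡ g g′) (Adj-translate k u∼g)
    ; ψ-into   = λ w w∼g′ → subst (λ x → Adj G m x (w // k)) g′//k≡g (Adj-translate (k ⁻¹) w∼g′)
    ; ψφ       = λ u _ → //-rightDividesʳ k u
    ; φψ       = λ w _ → //-rightDividesˡ k w
    ; adj-pres = λ u u′ _ _ → mk⇔ (Adj-translate k)
        (subst₂ (Adj G m) (//-rightDividesʳ k u) (//-rightDividesʳ k u′) ∘ Adj-translate (k ⁻¹))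
    }
    where
    k : Vec (FiniteGroup.Carrier G) m
    k = g \\ g′
    g′//k≡g : g′ // k ≡ g
    g′//k≡g = trans (cong (_// k) (sym (\\-leftDividesˡ g g′))) (//-rightDividesʳ k g)

inBlock : ∀ {m} → ℕ → ℕ → Fin m → Bool
inBlock k l i = does (k ≤? suc (toℕ i) ×-dec suc (toℕ i) <? l)

module _ {G : FiniteGroup} {m : ℕ} where

  open FiniteGroupProperties G

  lookup-block : ∀ x k l i → lookup (block G m x k l) i ≡ (if inBlock k l i then x else e)
  lookup-block x k l i = lookup∘tabulate _ i

  lookup-// : ∀ (v w : Vec Carrier m) i → lookup (_·ᵥ_ G m v (_⁻¹ᵥ G m w)) i ≡ lookup v i // lookup w i
  lookup-// v w i = trans (lookup-zipWith _∙_ i v _) (cong (lookup v i ∙_) (lookup-map i _⁻¹ w))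

  InS-values : ∀ {v} → InS G m v → ∃[ x ] ∀ i → lookup v i ∈⟨e, x ⟩
  InS-values (x , k , l , _ , _ , _ , _ , refl) = x , λ i →
    subst (_∈⟨e, x ⟩) (sym (lookup-block x k l i)) (if-values (inBlock k l i))
    where
    if-values : ∀ b → (if b then x else e) ∈⟨e, x ⟩
    if-values true  = inj₂ refl
    if-values false = inj₁ refl

module _ {G H : FiniteGroup} {m : ℕ} where

  private
    module G = FiniteGroupProperties G
    module H = FiniteGroupProperties H

  InS-transfer : ∀ {v w} →
    (∀ i j → lookup v i ≡ lookup v j → lookup w i ≡ lookup w j) →
    (∀ i → lookup v i ≡ G.e ⇔ lookup w i ≡ H.e) →
    InS G m v → InS H m w
  InS-transfer {w = w} same same-e (x , suc k , l , x≢e , 1≤k , k<l , l≤ , refl) =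
    lookup w i₀ , suc k , l , w₀≢e , 1≤k , k<l , l≤ , w≡block
    where
    -- the first coordinate of the block (block numbers coordinates from 1)
    i₀ : Fin m
    i₀ = fromℕ< (≤-pred (≤-trans k<l l≤))
    v₀≡x : lookup (block G m x (suc k) l) i₀ ≡ x
    v₀≡x = trans (lookup-block {G} x (suc k) l i₀)
      (cong (if_then x else G.e) (dec-true (suc k ≤? suc (toℕ i₀) ×-dec suc (toℕ i₀) <? l)
        (≤-reflexive (cong suc (sym toℕ-i₀)) , subst (λ j → suc j < l) (sym toℕ-i₀) k<l)))
      where
      toℕ-i₀ : toℕ i₀ ≡ k
      toℕ-i₀ = toℕ-fromℕ< (≤-pred (≤-trans k<l l≤))
    w₀≢e : lookup w i₀ ≢ H.e
    w₀≢e w₀≡e = x≢e (trans (sym v₀≡x) (Equivalence.from (same-e i₀) w₀≡e))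
    pointwise : ∀ i b → lookup (block G m x (suc k) l) i ≡ (if b then x else G.e) →
                lookup w i ≡ (if b then lookup w i₀ else H.e)
    pointwise i true  vᵢ≡x = same i i₀ (trans vᵢ≡x (sym v₀≡x))
    pointwise i false vᵢ≡e = Equivalence.to (same-e i) vᵢ≡e
    w≡block : w ≡ block H m (lookup w i₀) (suc k) l
    w≡block = trans (sym (tabulate∘lookup w))
      (tabulate-cong λ i → pointwise i (inBlock (suc k) l i) (lookup-block {G} x (suc k) l i))

module _ {G H : FiniteGroup} {m : ℕ} where

  private
    module G = FiniteGroupProperties G
    module H = FiniteGroupProperties H

  InS-pattern : ∀ {v w} →
    (∀ i j → lookup v i ≡ lookup v j ⇔ lookup w i ≡ lookup w j) →
    (∀ i → lookup v i ≡ G.e ⇔ lookup w i ≡ H.e) →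
    InS G m v ⇔ InS H m w
  InS-pattern same same-e = mk⇔
    (InS-transfer {G} {H} {m} (λ i j → Equivalence.to (same i j)) same-e)
    (InS-transfer {H} {G} {m} (λ i j → Equivalence.from (same i j)) (⇔-sym ∘ same-e))

  InS-map : ∀ {v} (F : G.Carrier → H.Carrier) → (∀ {a b} → F a ≡ F b → a ≡ b) → F G.e ≡ H.e →
            InS G m v → InS H m (map F v)
  InS-map {v} F F-injective F-e = Equivalence.to (InS-pattern
    (λ i j → ≡-resp-⇔ refl refl (lookup-map i F v) (lookup-map j F v) (mk⇔ (cong F) F-injective))
    (λ i → ≡-resp-⇔ refl refl (lookup-map i F v) (sym F-e) (mk⇔ (cong F) F-injective)))

Adj-ε⇔InS : ∀ {G m u} → Adj G m (replicate m (FiniteGroup.e G)) u ⇔ InS G m u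
Adj-ε⇔InS {G} {m} {u} = mk⇔ (subst (InS G m) u//ε≡u) (subst (InS G m) (sym u//ε≡u))
  where
  u//ε≡u : _·ᵥ_ G m u (_⁻¹ᵥ G m (replicate m (FiniteGroup.e G))) ≡ u
  u//ε≡u = LoopProperties.x//ε≈x (GroupProperties.loop (vecGroup G m)) u

module _ {G H : FiniteGroup} (B : InverseCompatibleBijection G H) where

  open InverseCompatibleBijection B
  private
    module G = FiniteGroupProperties G
    module H = FiniteGroupProperties H

  -- F is not a homomorphism, but it behaves like one on pairs of elements of a common set {e, x}.
  to-\\ : ∀ {x a a′} → a G.∈⟨e, x ⟩ → a′ G.∈⟨e, x ⟩ → to (a′ G.\\ a) ≡ to a′ H.\\ to a
  to-\\ {a′ = a′} (inj₁ refl) _ = begin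
    to (a′ G.⁻¹ G.∙ G.e) ≡⟨ cong to (G.identityʳ _) ⟩
    to (a′ G.⁻¹)         ≡⟨ to-⁻¹ a′ ⟩
    to a′ H.⁻¹           ≡⟨ H.identityʳ _ ⟨
    to a′ H.⁻¹ H.∙ H.e   ≡⟨ cong (to a′ H.\\_) to-e ⟨
    to a′ H.\\ to G.e    ∎
    where open ≡-Reasoning
  to-\\ {x} (inj₂ refl) (inj₁ refl) = begin
    to (G.e G.\\ x)  ≡⟨ cong to (G.ε\\x≈x x) ⟩
    to x             ≡⟨ H.ε\\x≈x (to x) ⟨
    H.e H.\\ to x    ≡⟨ cong (H._\\ to x) to-e ⟨
    to G.e H.\\ to x ∎
    where open ≡-Reasoning
  to-\\ {x} (inj₂ refl) (inj₂ refl) =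
    trans (cong to (G.x\\x≈ε x)) (trans to-e (sym (H.x\\x≈ε (to x))))

  to-//-≡ : ∀ {x x′ a a′ b b′} → a G.∈⟨e, x′ ⟩ → a′ G.∈⟨e, x′ ⟩ → b G.∈⟨e, x ⟩ → b′ G.∈⟨e, x ⟩ →
            a G.// b ≡ a′ G.// b′ ⇔ to a H.// to b ≡ to a′ H.// to b′
  to-//-≡ {a = a} {a′} {b} {b′} a∈ a′∈ b∈ b′∈ = mk⇔
    (λ eq → \\-≈⇒//-≈ H.group (begin
      to a′ H.\\ to a  ≡⟨ to-\\ a∈ a′∈ ⟨
      to (a′ G.\\ a)   ≡⟨ cong to (//-≈⇒\\-≈ G.group eq) ⟩
      to (b′ G.\\ b)   ≡⟨ to-\\ b∈ b′∈ ⟩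
      to b′ H.\\ to b  ∎))
    (λ eq → \\-≈⇒//-≈ G.group (to-injective (begin
      to (a′ G.\\ a)   ≡⟨ to-\\ a∈ a′∈ ⟩
      to a′ H.\\ to a  ≡⟨ //-≈⇒\\-≈ H.group eq ⟩
      to b′ H.\\ to b  ≡⟨ to-\\ b∈ b′∈ ⟨
      to (b′ G.\\ b)   ∎)))
    where open ≡-Reasoning

  to-//-≡e : ∀ {a b} → a G.// b ≡ G.e ⇔ to a H.// to b ≡ H.e
  to-//-≡e {a} {b} = mk⇔
    (λ eq → H.x≈y⇒x∙y⁻¹≈ε (cong to (G.x∙y⁻¹≈ε⇒x≈y a b eq)))
    (λ eq → G.x≈y⇒x∙y⁻¹≈ε (to-injective (H.x∙y⁻¹≈ε⇒x≈y (to a) (to b) eq)))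

  mapIso : ∀ {m} → NbhdIso G H m (replicate m G.e) (replicate m H.e)
  mapIso {m} = record
    { φ        = map to
    ; ψ        = map from
    ; φ-into   = λ u → from-InS H ∘ InS-map {G} {H} {m} to to-injective to-e ∘ to-InS G
    ; ψ-into   = λ w → from-InS G ∘ InS-map {H} {G} {m} from from-injective from-e ∘ to-InS H
    ; ψφ       = λ u _ → map-from-to u
    ; φψ       = λ w _ → map-to-from w
    ; adj-pres = adj-pres
    }
    where
    to-InS : ∀ K {u} → Adj K m (replicate m (FiniteGroup.e K)) u → InS K m u
    to-InS K = Equivalence.to (Adj-ε⇔InS {K})
    from-InS : ∀ K {u} → InS K m u → Adj K m (replicate m (FiniteGroup.e K)) u
    from-InS K = Equivalence.from (Adj-ε⇔InS {K})

    map-from-to : ∀ u → map from (map to u) ≡ u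
    map-from-to u = trans (sym (map-∘ from to u)) (trans (map-cong from-to u) (map-id u))

    map-to-from : ∀ w → map to (map from w) ≡ w
    map-to-from w = trans (sym (map-∘ to from w)) (trans (map-cong to-from w) (map-id w))

    adj-pres : ∀ u u′ → Adj G m (replicate m G.e) u → Adj G m (replicate m G.e) u′ →
               Adj G m u u′ ⇔ Adj H m (map to u) (map to u′)
    adj-pres u u′ u∼ε u′∼ε with InS-values {G} {m} (to-InS G u∼ε) | InS-values {G} {m} (to-InS G u′∼ε)
    ... | _ , u∈ | _ , u′∈ = InS-pattern {G} {H}
      (λ i j → ≡-resp-⇔ (quotient-G i) (quotient-G j) (quotient-H i) (quotient-H j)
                 (to-//-≡ (u′∈ i) (u′∈ j) (u∈ i) (u∈ j)))
      (λ i → ≡-resp-⇔ (quotient-G i) refl (quotient-H i) refl to-//-≡e)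
      where
      quotient-G : ∀ i → lookup (_·ᵥ_ G m u′ (_⁻¹ᵥ G m u)) i ≡ lookup u′ i G.// lookup u i
      quotient-G = lookup-// {G} u′ u
      quotient-H : ∀ i → lookup (_·ᵥ_ H m (map to u′) (_⁻¹ᵥ H m (map to u))) i
                         ≡ to (lookup u′ i) H.// to (lookup u i)
      quotient-H i = trans (lookup-// {H} (map to u′) (map to u) i)
                           (cong₂ H._//_ (lookup-map i to u′) (lookup-map i to u))

proposition4p3 : (G H : FiniteGroup) →
    FiniteGroup.size G ≡ FiniteGroup.size H →
    FiniteGroup.numOrder2 G ≡ FiniteGroup.numOrder2 H →
    (m : ℕ) → 1 < m →
    (g : Vec (FiniteGroup.Carrier G) m) (h : Vec (FiniteGroup.Carrier H) m) →
    NbhdIso G H m g h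
proposition4p3 G H |G|≡|H| #G≡#H m _ g h =
  NbhdIso-trans (translationIso g εG)
    (NbhdIso-trans (mapIso (inverseCompatibleBijection G H |G|≡|H| #G≡#H)) (translationIso εH h))
  where
  εG = replicate m (FiniteGroup.e G)
  εH = replicate m (FiniteGroup.e H)
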